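{- Let $m$ be an integer, $p$ an odd integer and $n$ a positive integer. Then \[ \sum_{j=1}^n\binom{n}{j}\Big\lfloor\frac{j}{2}\Big\rfloor F_{2pj+m}= \begin{cases} \frac{n\sqrt{5^{n-1}}}{2}F_p^{n-1}F_{p(n+1)+m}-\frac{\sqrt{5^{n-1}}}{4}F_p^nL_{pn+m}-\frac14L_p^nF_{pn+m}, & n\text{ odd};\\[4pt] \frac{n\sqrt{5^{n-2}}}{2}F_p^{n-1}L_{p(n+1)+m}-\frac{\sqrt{5^{n}}}{4}F_p^nF_{pn+m}+\frac14L_p^nF_{pn+m}, & n\text{ even}, \end{cases} \] and \[ \sum_{j=1}^n\binom{n}{j}\Big\lfloor\frac{j}{2}\Big\rfloor L_{2pj+m}= \begin{cases} \frac{n\sqrt{5^{n-1}}}{2}F_p^{n-1}L_{p(n+1)+m}-\frac{\sqrt{5^{n+1}}}{4}F_p^nF_{pn+m}-\frac14L_p^nL_{pn+m}, & n\text{ odd};\\[4pt] \frac{n\sqrt{5^{n}}}{2}F_p^{n-1}F_{p(n+1)+m}-\frac{\sqrt{5^{n}}}{4}F_p^nL_{pn+m}+\frac14L_p^nL_{pn+m}, & n\text{ even}. \end{cases} \]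
   Context: $F_n$ and $L_n$ are the Fibonacci and Lucas numbers, defined for all integers $n$ by $F_n=(\alpha^n-\beta^n)/\sqrt5$, $L_n=\alpha^n+\beta^n$ with $\alpha=(1+\sqrt5)/2$, $\beta=(1-\sqrt5)/2$. $\lfloor x\rfloor$ is the floor function. -}

module Defs where

open import Data.Nat as ℕ using (ℕ; zero; suc)
open import Data.Nat.Combinatorics using (_C_)
open import Data.Integer using (ℤ; +_; -[1+_]; _+_; _-_; _*_; -_; _^_)

fibℕ : ℕ → ℤ
fibℕ zero = + 0
fibℕ (suc zero) = + 1
fibℕ (suc (suc n)) = fibℕ (suc n) + fibℕ n

lucℕ : ℕ → ℤ
lucℕ zero = + 2
lucℕ (suc zero) = + 1
lucℕ (suc (suc n)) = lucℕ (suc n) + lucℕ n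

sgn : ℕ → ℤ
sgn n = (- + 1) ^ n

-- Extension to all integer indices, consistent with the Binet formulas:
-- F_{-n} = (-1)^{n+1} F_n,  L_{-n} = (-1)^n L_n.
F : ℤ → ℤ
F (+ n) = fibℕ n
F -[1+ n ] = sgn n * fibℕ (suc n)

L : ℤ → ℤ
L (+ n) = lucℕ n
L -[1+ n ] = sgn (suc n) * lucℕ (suc n)

sum1 : ℕ → (ℕ → ℤ) → ℤ
sum1 zero f = + 0
sum1 (suc n) f = sum1 n f + f (suc n)

S : (ℤ → ℤ) → ℤ → ℤ → ℕ → ℤ
S G p m n = sum1 n (λ j → + (n C j) * + (j ℕ./ 2) * G (+ 2 * p * + j + m))

-- Work in ℤ[φ] with φ² = φ + 1, where φ^z = F_{z-1} + F_z φ: the Fibonacci and Lucas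
-- numbers are the φ-coordinates of φ^z and of √5 φ^z, with √5 = 2φ - 1. Since
-- 4⌊j/2⌋ = 2j - 1 + (-1)^j, the binomial theorem and its derivative give
-- Σ_j C(n,j) 4⌊j/2⌋ x^j = 2n x (1+x)^(n-1) - (1+x)^n + (1-x)^n, applied to x = φ^(2p).
-- For odd p the unit φ^p has norm -1, which factors 1 + φ^(2p) = √5 F_p φ^p and
-- 1 - φ^(2p) = -L_p φ^p. Expanding the powers and reading off φ-coordinates gives the
-- formulas; the parity of n decides whether √5^(n-1) is an integer.
module Submission where

open import Algebra.Bundles using (CommutativeSemiring; CommutativeRing)
open import Data.Integer as Int using (ℤ; +_; -[1+_])
import Data.Integer.Properties as ℤ
open import Data.Integer.Tactic.RingSolver using (solve; solve-∀)
open import Data.List using (_∷_; [])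
open import Data.Maybe using (nothing)
open import Data.Nat as ℕ using (ℕ; zero; suc)
import Data.Nat.Properties as ℕ
open import Data.Nat.Combinatorics using (_C_; nCk+nC[k+1]≡[n+1]C[k+1]; k>n⇒nCk≡0)
open import Data.Nat.DivMod using (_/_; m/n≡1+[m∸n]/n)
open import Data.Nat.Tactic.RingSolver using () renaming (solve-∀ to ℕ-solve-∀)
open import Data.Product as Product using (_,_; proj₂; ∃-syntax)
open import Function using (_∘_)
open import Level using (0ℓ)
open import Relation.Binary.PropositionalEquality as ≡ using (_≡_; module ≡-Reasoning)
import Tactic.RingSolver.Core.AlmostCommutativeRing as ACR

open import Defs

-- Binomial sums

module BinomialSums {c ℓ} (R : CommutativeSemiring c ℓ) where

  open CommutativeSemiring R
  open import Algebra.Properties.CommutativeSemiring.Exp R using (_^_)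
  open import Algebra.Properties.Semiring.Mult semiring using (_×_; ×-homo-+; ×-congˡ; ×-congʳ; ×-comm-*)
  open import Algebra.Properties.CommutativeMonoid.Mult +-commutativeMonoid using (×-distrib-+)
  open import Algebra.Properties.CommutativeSemigroup +-commutativeSemigroup using (interchange; x∙yz≈y∙xz)
  open import Algebra.Properties.CommutativeSemigroup *-commutativeSemigroup using ()
    renaming (x∙yz≈y∙xz to x*yz≈y*xz)
  open import Relation.Binary.Reasoning.Setoid setoid

  ∑≤ : ℕ → (ℕ → Carrier) → Carrier
  ∑≤ zero    f = f 0
  ∑≤ (suc n) f = ∑≤ n f + f (suc n)

  ∑≤-cong : ∀ n {f g : ℕ → Carrier} → (∀ j → f j ≈ g j) → ∑≤ n f ≈ ∑≤ n g
  ∑≤-cong zero    f≈g = f≈g 0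
  ∑≤-cong (suc n) f≈g = +-cong (∑≤-cong n f≈g) (f≈g (suc n))

  ∑≤-+ : ∀ n f g → ∑≤ n (λ j → f j + g j) ≈ ∑≤ n f + ∑≤ n g
  ∑≤-+ zero    f g = refl
  ∑≤-+ (suc n) f g = trans (+-congʳ (∑≤-+ n f g)) (interchange _ _ _ _)

  *-distribˡ-∑≤ : ∀ n a f → a * ∑≤ n f ≈ ∑≤ n (λ j → a * f j)
  *-distribˡ-∑≤ zero    a f = refl
  *-distribˡ-∑≤ (suc n) a f = trans (distribˡ a _ _) (+-congʳ (*-distribˡ-∑≤ n a f))

  ∑≤-suc : ∀ n f → ∑≤ (suc n) f ≈ f 0 + ∑≤ n (f ∘ suc)
  ∑≤-suc zero    f = refl
  ∑≤-suc (suc n) f = trans (+-congʳ (∑≤-suc n f)) (+-assoc _ _ _)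

  binomialSum : ℕ → (ℕ → Carrier) → Carrier
  binomialSum n f = ∑≤ n (λ j → (n C j) × f j)

  binomialSum-cong : ∀ n {f g : ℕ → Carrier} → (∀ j → f j ≈ g j) → binomialSum n f ≈ binomialSum n g
  binomialSum-cong n f≈g = ∑≤-cong n (λ j → ×-congʳ (n C j) (f≈g j))

  binomialSum-+ : ∀ n f g → binomialSum n (λ j → f j + g j) ≈ binomialSum n f + binomialSum n g
  binomialSum-+ n f g = trans (∑≤-cong n (λ j → ×-distrib-+ (f j) (g j) (n C j))) (∑≤-+ n _ _)

  *-distribˡ-binomialSum : ∀ n a f → a * binomialSum n f ≈ binomialSum n (λ j → a * f j)
  *-distribˡ-binomialSum n a f = trans (*-distribˡ-∑≤ n a _) (∑≤-cong n (λ j → ×-comm-* (n C j) a (f j)))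

  -- Pascal's rule; the extra term C(n, n+1) f(n+1) of the shifted sum vanishes.
  binomialSum-suc : ∀ n f → binomialSum (suc n) f ≈ binomialSum n f + binomialSum n (f ∘ suc)
  binomialSum-suc n f = begin
    binomialSum (suc n) f
      ≈⟨ ∑≤-suc n _ ⟩
    t 0 + ∑≤ n (λ j → (suc n C suc j) × f (suc j))
      ≈⟨ +-congˡ (∑≤-cong n pascal) ⟩
    t 0 + ∑≤ n (λ j → (n C j) × f (suc j) + t (suc j))
      ≈⟨ +-congˡ (∑≤-+ n _ _) ⟩
    t 0 + (binomialSum n (f ∘ suc) + ∑≤ n (t ∘ suc))
      ≈⟨ x∙yz≈y∙xz _ _ _ ⟩
    binomialSum n (f ∘ suc) + (t 0 + ∑≤ n (t ∘ suc))
      ≈⟨ +-congˡ (sym (∑≤-suc n t)) ⟩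
    binomialSum n (f ∘ suc) + (binomialSum n f + t (suc n))
      ≈⟨ +-congˡ (trans (+-congˡ (×-congˡ (k>n⇒nCk≡0 (ℕ.n<1+n n)))) (+-identityʳ _)) ⟩
    binomialSum n (f ∘ suc) + binomialSum n f
      ≈⟨ +-comm _ _ ⟩
    binomialSum n f + binomialSum n (f ∘ suc) ∎
    where
    t : ℕ → Carrier
    t j = (n C j) × f j
    pascal : ∀ j → (suc n C suc j) × f (suc j) ≈ (n C j) × f (suc j) + t (suc j)
    pascal j = trans (×-congˡ (≡.sym (nCk+nC[k+1]≡[n+1]C[k+1] n j))) (×-homo-+ _ (n C j) _)

  binomial-theorem : ∀ x n → binomialSum n (x ^_) ≈ (1# + x) ^ n
  binomial-theorem x zero    = +-identityʳ 1#
  binomial-theorem x (suc n) = begin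
    binomialSum (suc n) (x ^_)                             ≈⟨ binomialSum-suc n _ ⟩
    binomialSum n (x ^_) + binomialSum n (λ j → x * x ^ j) ≈⟨ +-cong (sym (*-identityˡ _)) (sym (*-distribˡ-binomialSum n x _)) ⟩
    1# * binomialSum n (x ^_) + x * binomialSum n (x ^_)   ≈⟨ sym (distribʳ _ 1# x) ⟩
    (1# + x) * binomialSum n (x ^_)                        ≈⟨ *-congˡ (binomial-theorem x n) ⟩
    (1# + x) * (1# + x) ^ n                                ∎

  binomialSum-weighted-suc : ∀ x n → binomialSum (suc n) (λ j → j × x ^ j)
                                     ≈ (1# + x) * binomialSum n (λ j → j × x ^ j) + x * (1# + x) ^ n
  binomialSum-weighted-suc x n = begin
    binomialSum (suc n) g                         ≈⟨ binomialSum-suc n g ⟩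
    B + binomialSum n (g ∘ suc)                   ≈⟨ +-congˡ (binomialSum-cong n g-suc) ⟩
    B + binomialSum n (λ j → x * (x ^ j + g j))   ≈⟨ +-congˡ (sym (*-distribˡ-binomialSum n x _)) ⟩
    B + x * binomialSum n (λ j → x ^ j + g j)     ≈⟨ +-congˡ (*-congˡ (binomialSum-+ n _ _)) ⟩
    B + x * (binomialSum n (x ^_) + B)            ≈⟨ +-congˡ (*-congˡ (+-congʳ (binomial-theorem x n))) ⟩
    B + x * ((1# + x) ^ n + B)                    ≈⟨ +-congˡ (distribˡ x _ _) ⟩
    B + (x * (1# + x) ^ n + x * B)                ≈⟨ x∙yz≈y∙xz _ _ _ ⟩
    x * (1# + x) ^ n + (B + x * B)                ≈⟨ +-comm _ _ ⟩
    B + x * B + x * (1# + x) ^ n                  ≈⟨ +-congʳ (+-congʳ (sym (*-identityˡ B))) ⟩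
    1# * B + x * B + x * (1# + x) ^ n             ≈⟨ +-congʳ (sym (distribʳ B 1# x)) ⟩
    (1# + x) * B + x * (1# + x) ^ n               ∎
    where
    g : ℕ → Carrier
    g j = j × x ^ j
    B : Carrier
    B = binomialSum n g
    g-suc : ∀ j → g (suc j) ≈ x * (x ^ j + g j)
    g-suc j = trans (+-congˡ (sym (×-comm-* j x (x ^ j)))) (sym (distribˡ x _ _))

  binomialSum-weighted : ∀ x n → binomialSum (suc n) (λ j → j × x ^ j) ≈ suc n × (x * (1# + x) ^ n)
  binomialSum-weighted x zero = begin
    binomialSum 1 (λ j → j × x ^ j)     ≈⟨ binomialSum-weighted-suc x 0 ⟩
    (1# + x) * (0# + 0#) + x * 1#       ≈⟨ +-congʳ (trans (*-congˡ (+-identityʳ 0#)) (zeroʳ _)) ⟩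
    0# + x * 1#                         ≈⟨ +-comm _ _ ⟩
    x * 1# + 0#                         ∎
  binomialSum-weighted x (suc n) = begin
    binomialSum (suc (suc n)) (λ j → j × x ^ j)          ≈⟨ binomialSum-weighted-suc x (suc n) ⟩
    (1# + x) * binomialSum (suc n) (λ j → j × x ^ j) + y ≈⟨ +-congʳ (*-congˡ (binomialSum-weighted x n)) ⟩
    (1# + x) * (suc n × (x * (1# + x) ^ n)) + y          ≈⟨ +-congʳ (×-comm-* (suc n) _ _) ⟩
    suc n × ((1# + x) * (x * (1# + x) ^ n)) + y          ≈⟨ +-congʳ (×-congʳ (suc n) (x*yz≈y*xz _ _ _)) ⟩
    suc n × y + y                                        ≈⟨ +-comm _ _ ⟩
    suc (suc n) × y                                      ∎
    where
    y : Carrier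
    y = x * (1# + x) ^ suc n

module FloorHalfBinomialSums {c ℓ} (R : CommutativeRing c ℓ) where

  open CommutativeRing R
  open BinomialSums commutativeSemiring
  open import Algebra.Properties.CommutativeSemiring.Exp commutativeSemiring using (_^_; ^-congˡ; ^-distrib-*)
  open import Algebra.Properties.Semiring.Mult semiring using (_×_; ×-homo-+; ×-congˡ)
  open import Algebra.Properties.Ring ring using (-1*x≈-x; -‿involutive)
  open import Relation.Binary.Reasoning.Setoid setoid

  -- 4⌊j/2⌋ = 2j - 1 + (-1)^j, with the -1 moved across so that only ℕ-multiples occur.
  ×-4⌊/2⌋ : ∀ j y → (4 ℕ.* (j / 2)) × y + y ≈ (2 ℕ.* j) × y + (- 1#) ^ j * y
  ×-4⌊/2⌋ zero          y = +-congˡ (sym (*-identityˡ y))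
  ×-4⌊/2⌋ (suc zero)    y = begin
    0# + y                  ≈⟨ trans (+-identityˡ y) (sym (+-identityʳ y)) ⟩
    y + 0#                  ≈⟨ +-congˡ (sym (-‿inverseʳ y)) ⟩
    y + (y - y)             ≈⟨ sym (+-assoc y y (- y)) ⟩
    y + y - y               ≈⟨ +-cong (+-congˡ (sym (+-identityʳ y))) (sym (trans (*-congʳ (*-identityʳ (- 1#))) (-1*x≈-x y))) ⟩
    2 × y + (- 1#) ^ 1 * y  ∎
  ×-4⌊/2⌋ (suc (suc j)) y = begin
    (4 ℕ.* (suc (suc j) / 2)) × y + y               ≈⟨ +-congʳ (×-congˡ (≡.cong (4 ℕ.*_) ⌊/2⌋-suc-suc)) ⟩
    (4 ℕ.* suc (j / 2)) × y + y                     ≈⟨ +-congʳ (×-congˡ (ℕ.*-suc 4 (j / 2))) ⟩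
    (4 ℕ.+ 4 ℕ.* (j / 2)) × y + y                   ≈⟨ +-congʳ (×-homo-+ y 4 (4 ℕ.* (j / 2))) ⟩
    4 × y + (4 ℕ.* (j / 2)) × y + y                 ≈⟨ +-assoc _ _ _ ⟩
    4 × y + ((4 ℕ.* (j / 2)) × y + y)               ≈⟨ +-congˡ (×-4⌊/2⌋ j y) ⟩
    4 × y + ((2 ℕ.* j) × y + (- 1#) ^ j * y)        ≈⟨ sym (+-assoc _ _ _) ⟩
    4 × y + (2 ℕ.* j) × y + (- 1#) ^ j * y          ≈⟨ +-cong (sym (×-homo-+ y 4 (2 ℕ.* j))) (sym sign) ⟩
    (4 ℕ.+ 2 ℕ.* j) × y + (- 1#) ^ suc (suc j) * y  ≈⟨ +-congʳ (×-congˡ (≡.sym (ℕ.*-distribˡ-+ 2 2 j))) ⟩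
    (2 ℕ.* suc (suc j)) × y + (- 1#) ^ suc (suc j) * y ∎
    where
    ⌊/2⌋-suc-suc : suc (suc j) / 2 ≡ suc (j / 2)
    ⌊/2⌋-suc-suc = m/n≡1+[m∸n]/n {suc (suc j)} {2} (ℕ.s≤s (ℕ.s≤s ℕ.z≤n))
    sign : (- 1#) ^ suc (suc j) * y ≈ (- 1#) ^ j * y
    sign = *-congʳ (trans (-1*x≈-x _) (trans (-‿cong (-1*x≈-x _)) (-‿involutive _)))

  binomialSum-4⌊/2⌋ : ∀ x n → let U = suc n × (x * (1# + x) ^ n) in
    binomialSum (suc n) (λ j → (4 ℕ.* (j / 2)) × x ^ j) ≈ U + U + (1# - x) ^ suc n - (1# + x) ^ suc n
  binomialSum-4⌊/2⌋ x n = begin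
    W              ≈⟨ sym (trans (+-congˡ (-‿inverseʳ A)) (+-identityʳ W)) ⟩
    W + (A - A)    ≈⟨ sym (+-assoc W A (- A)) ⟩
    W + A - A      ≈⟨ +-congʳ W+A ⟩
    U + U + C - A  ∎
    where
    N : ℕ
    N = suc n
    W A C U : Carrier
    W = binomialSum N (λ j → (4 ℕ.* (j / 2)) × x ^ j)
    A = (1# + x) ^ N
    C = (1# - x) ^ N
    U = N × (x * (1# + x) ^ n)
    double : ∀ j z → (2 ℕ.* j) × z ≈ j × z + j × z
    double j z = trans (×-homo-+ z j (j ℕ.+ 0)) (+-congˡ (×-congˡ (ℕ.+-identityʳ j)))
    sign : ∀ j → (- 1#) ^ j * x ^ j ≈ (- x) ^ j
    sign j = sym (trans (^-congˡ j (sym (-1*x≈-x x))) (^-distrib-* (- 1#) x j))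
    W+A : W + A ≈ U + U + C
    W+A = begin
      W + A
        ≈⟨ +-congˡ (sym (binomial-theorem x N)) ⟩
      W + binomialSum N (x ^_)
        ≈⟨ sym (binomialSum-+ N _ _) ⟩
      binomialSum N (λ j → (4 ℕ.* (j / 2)) × x ^ j + x ^ j)
        ≈⟨ binomialSum-cong N (λ j → trans (×-4⌊/2⌋ j (x ^ j)) (+-cong (double j (x ^ j)) (sign j))) ⟩
      binomialSum N (λ j → j × x ^ j + j × x ^ j + (- x) ^ j)
        ≈⟨ binomialSum-+ N _ _ ⟩
      binomialSum N (λ j → j × x ^ j + j × x ^ j) + binomialSum N ((- x) ^_)
        ≈⟨ +-cong (binomialSum-+ N _ _) (binomial-theorem (- x) N) ⟩
      binomialSum N (λ j → j × x ^ j) + binomialSum N (λ j → j × x ^ j) + C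
        ≈⟨ +-congʳ (+-cong (binomialSum-weighted x n) (binomialSum-weighted x n)) ⟩
      U + U + C
        ∎

open ≡ using (refl; sym; trans; cong; cong₂; isEquivalence)
open Int using (_+_; _-_; _*_; -_; _^_)
open Product using (_×_)

-- The ring ℤ[φ]

-- (a , b) stands for a + bφ, and φ² = φ + 1.
ℤφ : Set
ℤφ = ℤ × ℤ

infixl 6 _+ᵩ_
infixl 7 _*ᵩ_
infix  8 -ᵩ_

_+ᵩ_ : ℤφ → ℤφ → ℤφ
(a , b) +ᵩ (c , d) = (a + c , b + d)

-ᵩ_ : ℤφ → ℤφ
-ᵩ (a , b) = (- a , - b)

_*ᵩ_ : ℤφ → ℤφ → ℤφ
(a , b) *ᵩ (c , d) = (a * c + b * d , a * d + b * c + b * d)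

0ᵩ 1ᵩ : ℤφ
0ᵩ = (+ 0 , + 0)
1ᵩ = (+ 1 , + 0)

*ᵩ-comm : ∀ x y → x *ᵩ y ≡ y *ᵩ x
*ᵩ-comm (a , b) (c , d) = cong₂ _,_ (solve (a ∷ b ∷ c ∷ d ∷ [])) (solve (a ∷ b ∷ c ∷ d ∷ []))

*ᵩ-identityˡ : ∀ x → 1ᵩ *ᵩ x ≡ x
*ᵩ-identityˡ (a , b) = cong₂ _,_ (solve (a ∷ b ∷ [])) (solve (a ∷ b ∷ []))

*ᵩ-assoc : ∀ x y z → (x *ᵩ y) *ᵩ z ≡ x *ᵩ (y *ᵩ z)
*ᵩ-assoc (a , b) (c , d) (e , f) = cong₂ _,_ re im
  where
  re : (a * c + b * d) * e + (a * d + b * c + b * d) * f ≡ a * (c * e + d * f) + b * (c * f + d * e + d * f)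
  re = solve (a ∷ b ∷ c ∷ d ∷ e ∷ f ∷ [])
  im : (a * c + b * d) * f + (a * d + b * c + b * d) * e + (a * d + b * c + b * d) * f
     ≡ a * (c * f + d * e + d * f) + b * (c * e + d * f) + b * (c * f + d * e + d * f)
  im = solve (a ∷ b ∷ c ∷ d ∷ e ∷ f ∷ [])

*ᵩ-distribˡ : ∀ x y z → x *ᵩ (y +ᵩ z) ≡ x *ᵩ y +ᵩ x *ᵩ z
*ᵩ-distribˡ (a , b) (c , d) (e , f) = cong₂ _,_ re im
  where
  re : a * (c + e) + b * (d + f) ≡ (a * c + b * d) + (a * e + b * f)
  re = solve (a ∷ b ∷ c ∷ d ∷ e ∷ f ∷ [])
  im : a * (d + f) + b * (c + e) + b * (d + f) ≡ (a * d + b * c + b * d) + (a * f + b * e + b * f)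
  im = solve (a ∷ b ∷ c ∷ d ∷ e ∷ f ∷ [])

ℤφ-commutativeRing : CommutativeRing 0ℓ 0ℓ
ℤφ-commutativeRing = record
  { Carrier = ℤφ ; _≈_ = _≡_ ; _+_ = _+ᵩ_ ; _*_ = _*ᵩ_ ; -_ = -ᵩ_ ; 0# = 0ᵩ ; 1# = 1ᵩ
  ; isCommutativeRing = record
    { isRing = record
      { +-isAbelianGroup = record
        { isGroup = record
          { isMonoid = record
            { isSemigroup = record
              { isMagma = record { isEquivalence = isEquivalence ; ∙-cong = cong₂ _+ᵩ_ }
              ; assoc = λ (a , b) (c , d) (e , f) → cong₂ _,_ (ℤ.+-assoc a c e) (ℤ.+-assoc b d f) }
            ; identity = (λ (a , b) → cong₂ _,_ (ℤ.+-identityˡ a) (ℤ.+-identityˡ b))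
                       , (λ (a , b) → cong₂ _,_ (ℤ.+-identityʳ a) (ℤ.+-identityʳ b)) }
          ; inverse = (λ (a , b) → cong₂ _,_ (ℤ.+-inverseˡ a) (ℤ.+-inverseˡ b))
                    , (λ (a , b) → cong₂ _,_ (ℤ.+-inverseʳ a) (ℤ.+-inverseʳ b))
          ; ⁻¹-cong = cong -ᵩ_ }
        ; comm = λ (a , b) (c , d) → cong₂ _,_ (ℤ.+-comm a c) (ℤ.+-comm b d) }
      ; *-cong = cong₂ _*ᵩ_
      ; *-assoc = *ᵩ-assoc
      ; *-identity = *ᵩ-identityˡ , λ x → trans (*ᵩ-comm x 1ᵩ) (*ᵩ-identityˡ x)
      ; distrib = *ᵩ-distribˡ , λ x y z → trans (*ᵩ-comm (y +ᵩ z) x)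
                    (trans (*ᵩ-distribˡ x y z) (cong₂ _+ᵩ_ (*ᵩ-comm x y) (*ᵩ-comm x z))) }
    ; *-comm = *ᵩ-comm } }

ℤφ-ring : ACR.AlmostCommutativeRing 0ℓ 0ℓ
ℤφ-ring = ACR.fromCommutativeRing ℤφ-commutativeRing (λ _ → nothing)

open CommutativeRing ℤφ-commutativeRing using (commutativeSemiring; semiring)
open import Algebra.Properties.CommutativeSemiring.Exp commutativeSemiring using ()
  renaming (_^_ to _^ᵩ_; ^-distrib-* to ^ᵩ-distrib-*ᵩ; ^-assocʳ to ^ᵩ-assocʳ)
open import Algebra.Properties.Semiring.Mult semiring using () renaming (_×_ to _×ᵩ_; ×-comm-* to ×ᵩ-comm-*ᵩ)
open import Tactic.RingSolver.NonReflective ℤφ-ring using (_⊜_; _⊕_; _⊗_; ⊝_) renaming (solve to solve-ℤφ)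
open BinomialSums commutativeSemiring using (∑≤; binomialSum; *-distribˡ-binomialSum)
open FloorHalfBinomialSums ℤφ-commutativeRing using (binomialSum-4⌊/2⌋)

φ φ⁻¹ √5 : ℤφ
φ   = (+ 0 , + 1)
φ⁻¹ = (- + 1 , + 1)
√5  = (- + 1 , + 2)

ι : ℤ → ℤφ
ι c = (c , + 0)

φ-coeff : ℤφ → ℤ
φ-coeff = proj₂

φ^_ : ℤ → ℤφ
φ^ (+ n)    = φ ^ᵩ n
φ^ -[1+ n ] = φ⁻¹ ^ᵩ suc n

φ^-suc : ∀ z → φ^ (+ 1 + z) ≡ φ *ᵩ φ^ z
φ^-suc (+ n)        = refl
φ^-suc -[1+ zero ]  = refl
φ^-suc -[1+ suc n ] = sym (trans (sym (*ᵩ-assoc φ φ⁻¹ (φ^ -[1+ n ]))) (*ᵩ-identityˡ (φ^ -[1+ n ])))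

φ^-pred : ∀ z → φ^ (- + 1 + z) ≡ φ⁻¹ *ᵩ φ^ z
φ^-pred -[1+ n ]  = refl
φ^-pred (+ zero)  = refl
φ^-pred (+ suc n) = sym (trans (sym (*ᵩ-assoc φ⁻¹ φ (φ^ (+ n)))) (*ᵩ-identityˡ (φ^ (+ n))))

φ^-+ : ∀ a b → φ^ (a + b) ≡ φ^ a *ᵩ φ^ b
φ^-+ (+ zero)     b = trans (cong φ^_ (ℤ.+-identityˡ b)) (sym (*ᵩ-identityˡ (φ^ b)))
φ^-+ (+ suc n)    b = begin
  φ^ (+ 1 + + n + b)        ≡⟨ cong φ^_ (ℤ.+-assoc (+ 1) (+ n) b) ⟩
  φ^ (+ 1 + (+ n + b))      ≡⟨ φ^-suc (+ n + b) ⟩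
  φ *ᵩ φ^ (+ n + b)         ≡⟨ cong (φ *ᵩ_) (φ^-+ (+ n) b) ⟩
  φ *ᵩ (φ^ (+ n) *ᵩ φ^ b)   ≡⟨ *ᵩ-assoc φ (φ^ (+ n)) (φ^ b) ⟨
  φ^ (+ suc n) *ᵩ φ^ b      ∎
  where open ≡-Reasoning
φ^-+ -[1+ zero ]  b = φ^-pred b
φ^-+ -[1+ suc n ] b = begin
  φ^ (- + 1 + -[1+ n ] + b)     ≡⟨ cong φ^_ (ℤ.+-assoc (- + 1) -[1+ n ] b) ⟩
  φ^ (- + 1 + (-[1+ n ] + b))   ≡⟨ φ^-pred (-[1+ n ] + b) ⟩
  φ⁻¹ *ᵩ φ^ (-[1+ n ] + b)      ≡⟨ cong (φ⁻¹ *ᵩ_) (φ^-+ -[1+ n ] b) ⟩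
  φ⁻¹ *ᵩ (φ^ -[1+ n ] *ᵩ φ^ b)  ≡⟨ *ᵩ-assoc φ⁻¹ (φ^ -[1+ n ]) (φ^ b) ⟨
  φ^ -[1+ suc n ] *ᵩ φ^ b       ∎
  where open ≡-Reasoning

φ^-*ℕ : ∀ a j → φ^ (a * + j) ≡ φ^ a ^ᵩ j
φ^-*ℕ a zero    = cong φ^_ (ℤ.*-zeroʳ a)
φ^-*ℕ a (suc j) = trans (cong φ^_ (ℤ.*-suc a (+ j))) (trans (φ^-+ a (a * + j)) (cong (φ^ a *ᵩ_) (φ^-*ℕ a j)))

φ^-affine : ∀ a j b → φ^ (a * + j + b) ≡ φ^ a ^ᵩ j *ᵩ φ^ b
φ^-affine a j b = trans (φ^-+ (a * + j) b) (cong (_*ᵩ φ^ b) (φ^-*ℕ a j))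

-- Fibonacci and Lucas numbers as φ-coordinates

φ*ᵩ : ∀ a b → φ *ᵩ (a , b) ≡ (b , b + a)
φ*ᵩ a b = cong₂ _,_ (solve (a ∷ b ∷ [])) (solve (a ∷ b ∷ []))

φ⁻¹*ᵩ : ∀ a b → φ⁻¹ *ᵩ (a , b) ≡ (b - a , a)
φ⁻¹*ᵩ a b = cong₂ _,_ (solve (a ∷ b ∷ [])) (solve (a ∷ b ∷ []))

φ^-fib : ∀ n → φ ^ᵩ suc n ≡ (fibℕ n , fibℕ (suc n))
φ^-fib zero    = refl
φ^-fib (suc n) = trans (cong (φ *ᵩ_) (φ^-fib n)) (φ*ᵩ (fibℕ n) (fibℕ (suc n)))

φ⁻¹^-fib : ∀ n → φ⁻¹ ^ᵩ suc n ≡ (sgn (suc n) * fibℕ (suc (suc n)) , sgn n * fibℕ (suc n))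
φ⁻¹^-fib zero    = refl
φ⁻¹^-fib (suc n) = begin
  φ⁻¹ *ᵩ φ⁻¹ ^ᵩ suc n                        ≡⟨ cong (φ⁻¹ *ᵩ_) (φ⁻¹^-fib n) ⟩
  φ⁻¹ *ᵩ (s₁ * f₂ , s₀ * f₁)                 ≡⟨ φ⁻¹*ᵩ (s₁ * f₂) (s₀ * f₁) ⟩
  (s₀ * f₁ - s₁ * f₂ , s₁ * f₂)              ≡⟨ cong (_, s₁ * f₂) (recurrence s₀ (fibℕ n) f₁) ⟩
  (sgn (suc (suc n)) * (f₂ + f₁) , s₁ * f₂)  ∎
  where
  open ≡-Reasoning
  s₀ s₁ f₁ f₂ : ℤ
  s₀ = sgn n
  s₁ = sgn (suc n)
  f₁ = fibℕ (suc n)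
  f₂ = fibℕ (suc (suc n))
  recurrence : ∀ s a b → s * b - - + 1 * s * (b + a) ≡ - + 1 * (- + 1 * s) * (b + a + b)
  recurrence = solve-∀

F-as-coeff : ∀ z → F z ≡ φ-coeff (φ^ z)
F-as-coeff (+ zero)  = refl
F-as-coeff (+ suc n) = sym (cong φ-coeff (φ^-fib n))
F-as-coeff -[1+ n ]  = sym (cong φ-coeff (φ⁻¹^-fib n))

lucℕ-fibℕ : ∀ n → lucℕ (suc n) ≡ + 2 * fibℕ n + fibℕ (suc n)
lucℕ-fibℕ zero          = refl
lucℕ-fibℕ (suc zero)    = refl
lucℕ-fibℕ (suc (suc n)) = trans (cong₂ _+_ (lucℕ-fibℕ (suc n)) (lucℕ-fibℕ n)) (recurrence (fibℕ n) (fibℕ (suc n)))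
  where
  recurrence : ∀ a b → + 2 * b + (b + a) + (+ 2 * a + b) ≡ + 2 * (b + a) + (b + a + b)
  recurrence = solve-∀

φ-coeff-√5*ᵩ : ∀ a b → φ-coeff (√5 *ᵩ (a , b)) ≡ + 2 * a + b
φ-coeff-√5*ᵩ a b = coeff
  where
  coeff : - + 1 * b + + 2 * a + + 2 * b ≡ + 2 * a + b
  coeff = solve (a ∷ b ∷ [])

L-as-coeff : ∀ z → L z ≡ φ-coeff (√5 *ᵩ φ^ z)
L-as-coeff (+ zero)  = refl
L-as-coeff (+ suc n) = begin
  lucℕ (suc n)                              ≡⟨ lucℕ-fibℕ n ⟩
  + 2 * fibℕ n + fibℕ (suc n)               ≡⟨ φ-coeff-√5*ᵩ (fibℕ n) (fibℕ (suc n)) ⟨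
  φ-coeff (√5 *ᵩ (fibℕ n , fibℕ (suc n)))   ≡⟨ cong (λ y → φ-coeff (√5 *ᵩ y)) (φ^-fib n) ⟨
  φ-coeff (√5 *ᵩ φ^ (+ suc n))              ∎
  where open ≡-Reasoning
L-as-coeff -[1+ n ] = begin
  s₁ * lucℕ (suc n)                      ≡⟨ cong (s₁ *_) (lucℕ-fibℕ n) ⟩
  s₁ * (+ 2 * fibℕ n + f₁)               ≡⟨ recurrence (sgn n) (fibℕ n) f₁ ⟩
  + 2 * (s₁ * f₂) + s₀ * f₁              ≡⟨ φ-coeff-√5*ᵩ (s₁ * f₂) (s₀ * f₁) ⟨
  φ-coeff (√5 *ᵩ (s₁ * f₂ , s₀ * f₁))    ≡⟨ cong (λ y → φ-coeff (√5 *ᵩ y)) (φ⁻¹^-fib n) ⟨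
  φ-coeff (√5 *ᵩ φ^ -[1+ n ])            ∎
  where
  open ≡-Reasoning
  s₀ s₁ f₁ f₂ : ℤ
  s₀ = sgn n
  s₁ = sgn (suc n)
  f₁ = fibℕ (suc n)
  f₂ = fibℕ (suc (suc n))
  recurrence : ∀ s a b → - + 1 * s * (+ 2 * a + b) ≡ + 2 * (- + 1 * s * (b + a)) + s * b
  recurrence = solve-∀

-- Units of norm -1

norm : ℤφ → ℤ
norm (a , b) = a * a + a * b - b * b

norm-*ᵩ : ∀ x y → norm (x *ᵩ y) ≡ norm x * norm y
norm-*ᵩ (a , b) (c , d) = multiplicative
  where
  multiplicative : (a * c + b * d) * (a * c + b * d) + (a * c + b * d) * (a * d + b * c + b * d)
                     - (a * d + b * c + b * d) * (a * d + b * c + b * d)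
                   ≡ (a * a + a * b - b * b) * (c * c + c * d - d * d)
  multiplicative = solve (a ∷ b ∷ c ∷ d ∷ [])

-- The Galois conjugate, φ ↦ 1 - φ.
conj : ℤφ → ℤφ
conj (a , b) = (a + b , - b)

*ᵩ-conj : ∀ y → y *ᵩ conj y ≡ ι (norm y)
*ᵩ-conj (a , b) = cong₂ _,_ re im
  where
  re : a * (a + b) + b * - b ≡ a * a + a * b - b * b
  re = solve (a ∷ b ∷ [])
  im : a * - b + b * (a + b) + b * - b ≡ + 0
  im = solve (a ∷ b ∷ [])

+ᵩ-conj : ∀ y → y +ᵩ conj y ≡ ι (φ-coeff (√5 *ᵩ y))
+ᵩ-conj (a , b) = cong₂ _,_ (trans re (sym (φ-coeff-√5*ᵩ a b))) (ℤ.+-inverseʳ b)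
  where
  re : a + (a + b) ≡ + 2 * a + b
  re = solve (a ∷ b ∷ [])

-ᵩ-conj : ∀ y → y +ᵩ -ᵩ conj y ≡ √5 *ᵩ ι (φ-coeff y)
-ᵩ-conj (a , b) = cong₂ _,_ re im
  where
  re : a + - (a + b) ≡ - + 1 * b + + 2 * + 0
  re = solve (a ∷ b ∷ [])
  im : b + - - b ≡ - + 1 * + 0 + + 2 * b + + 2 * + 0
  im = solve (a ∷ b ∷ [])

-- Norm -1 means 1 = -y·conj y, so 1 ± y² factors through y ∓ conj y.
module _ (y : ℤφ) (norm-y : norm y ≡ - + 1) where

  private
    y*conj-y : y *ᵩ conj y ≡ -ᵩ 1ᵩ
    y*conj-y = trans (*ᵩ-conj y) (cong ι norm-y)

  1+square : 1ᵩ +ᵩ y *ᵩ y ≡ √5 *ᵩ ι (φ-coeff y) *ᵩ y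
  1+square = begin
    1ᵩ +ᵩ y *ᵩ y                ≡⟨ cong (λ u → -ᵩ u +ᵩ y *ᵩ y) y*conj-y ⟨
    -ᵩ (y *ᵩ conj y) +ᵩ y *ᵩ y  ≡⟨ factor y (conj y) ⟩
    (y +ᵩ -ᵩ conj y) *ᵩ y       ≡⟨ cong (_*ᵩ y) (-ᵩ-conj y) ⟩
    √5 *ᵩ ι (φ-coeff y) *ᵩ y    ∎
    where
    open ≡-Reasoning
    factor : ∀ y z → -ᵩ (y *ᵩ z) +ᵩ y *ᵩ y ≡ (y +ᵩ -ᵩ z) *ᵩ y
    factor = solve-ℤφ 2 (λ y z → ⊝ (y ⊗ z) ⊕ y ⊗ y ⊜ (y ⊕ ⊝ z) ⊗ y) refl

  1-square : 1ᵩ +ᵩ -ᵩ (y *ᵩ y) ≡ ι (- φ-coeff (√5 *ᵩ y)) *ᵩ y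
  1-square = begin
    1ᵩ +ᵩ -ᵩ (y *ᵩ y)                ≡⟨ cong (λ u → -ᵩ u +ᵩ -ᵩ (y *ᵩ y)) y*conj-y ⟨
    -ᵩ (y *ᵩ conj y) +ᵩ -ᵩ (y *ᵩ y)  ≡⟨ factor y (conj y) ⟩
    -ᵩ (y +ᵩ conj y) *ᵩ y            ≡⟨ cong (λ u → -ᵩ u *ᵩ y) (+ᵩ-conj y) ⟩
    ι (- φ-coeff (√5 *ᵩ y)) *ᵩ y     ∎
    where
    open ≡-Reasoning
    factor : ∀ y z → -ᵩ (y *ᵩ z) +ᵩ -ᵩ (y *ᵩ y) ≡ -ᵩ (y +ᵩ z) *ᵩ y
    factor = solve-ℤφ 2 (λ y z → ⊝ (y ⊗ z) ⊕ ⊝ (y ⊗ y) ⊜ ⊝ (y ⊕ z) ⊗ y) refl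

norm-^ᵩ-squared : ∀ u → norm u ≡ - + 1 → ∀ n → norm (u ^ᵩ n) * norm (u ^ᵩ n) ≡ + 1
norm-^ᵩ-squared u norm-u zero    = refl
norm-^ᵩ-squared u norm-u (suc n) = begin
  norm (u *ᵩ u ^ᵩ n) * norm (u *ᵩ u ^ᵩ n)  ≡⟨ cong (λ v → v * v) (trans (norm-*ᵩ u (u ^ᵩ n)) (cong (_* ν) norm-u)) ⟩
  - + 1 * ν * (- + 1 * ν)                  ≡⟨ sign-squared ν ⟩
  ν * ν                                    ≡⟨ norm-^ᵩ-squared u norm-u n ⟩
  + 1                                      ∎
  where
  open ≡-Reasoning
  ν : ℤ
  ν = norm (u ^ᵩ n)
  sign-squared : ∀ a → - + 1 * a * (- + 1 * a) ≡ a * a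
  sign-squared = solve-∀

norm-φ^-squared : ∀ z → norm (φ^ z) * norm (φ^ z) ≡ + 1
norm-φ^-squared (+ n)    = norm-^ᵩ-squared φ refl n
norm-φ^-squared -[1+ n ] = norm-^ᵩ-squared φ⁻¹ refl (suc n)

norm-φ^-odd : ∀ t → norm (φ^ (+ 2 * t + + 1)) ≡ - + 1
norm-φ^-odd t = begin
  norm (φ^ (+ 2 * t + + 1))     ≡⟨ cong (norm ∘ φ^_) (double t) ⟩
  norm (φ^ (t + t + + 1))       ≡⟨ cong norm (trans (φ^-+ (t + t) (+ 1)) (cong (_*ᵩ φ) (φ^-+ t t))) ⟩
  norm (φ^ t *ᵩ φ^ t *ᵩ φ)      ≡⟨ norm-*ᵩ (φ^ t *ᵩ φ^ t) φ ⟩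
  norm (φ^ t *ᵩ φ^ t) * - + 1   ≡⟨ cong (_* - + 1) (trans (norm-*ᵩ (φ^ t) (φ^ t)) (norm-φ^-squared t)) ⟩
  - + 1                         ∎
  where
  open ≡-Reasoning
  double : ∀ t → + 2 * t + + 1 ≡ t + t + + 1
  double = solve-∀

-- The sums S as φ-coordinates

ι-*ᵩ : ∀ a b → ι a *ᵩ ι b ≡ ι (a * b)
ι-*ᵩ a b = cong₂ _,_ re im
  where
  re : a * b + + 0 * + 0 ≡ a * b
  re = solve (a ∷ b ∷ [])
  im : a * + 0 + + 0 * b + + 0 * + 0 ≡ + 0
  im = solve (a ∷ b ∷ [])

ι-^ᵩ : ∀ a n → ι a ^ᵩ n ≡ ι (a ^ n)
ι-^ᵩ a zero    = refl
ι-^ᵩ a (suc n) = trans (cong (ι a *ᵩ_) (ι-^ᵩ a n)) (ι-*ᵩ a (a ^ n))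

φ-coeff-ι*ᵩ : ∀ c y → φ-coeff (ι c *ᵩ y) ≡ c * φ-coeff y
φ-coeff-ι*ᵩ c (a , b) = coeff
  where
  coeff : c * b + + 0 * a + + 0 * b ≡ c * b
  coeff = solve (a ∷ b ∷ c ∷ [])

φ-coeff-×ᵩ : ∀ k y → φ-coeff (k ×ᵩ y) ≡ + k * φ-coeff y
φ-coeff-×ᵩ zero    y = sym (ℤ.*-zeroˡ (φ-coeff y))
φ-coeff-×ᵩ (suc k) y = trans (cong (λ c → φ-coeff y + c) (φ-coeff-×ᵩ k y)) (sym (ℤ.suc-* (+ k) (φ-coeff y)))

φ-coeff-√5^2k : ∀ k y → φ-coeff (√5 ^ᵩ (2 ℕ.* k) *ᵩ y) ≡ (+ 5) ^ k * φ-coeff y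
φ-coeff-√5^2k k y = begin
  φ-coeff (√5 ^ᵩ (2 ℕ.* k) *ᵩ y)   ≡⟨ cong (λ u → φ-coeff (u *ᵩ y)) (^ᵩ-assocʳ √5 2 k) ⟨
  φ-coeff (ι (+ 5) ^ᵩ k *ᵩ y)      ≡⟨ cong (λ u → φ-coeff (u *ᵩ y)) (ι-^ᵩ (+ 5) k) ⟩
  φ-coeff (ι ((+ 5) ^ k) *ᵩ y)     ≡⟨ φ-coeff-ι*ᵩ ((+ 5) ^ k) y ⟩
  (+ 5) ^ k * φ-coeff y            ∎
  where open ≡-Reasoning

φ-coeff-√5^-suc : ∀ j y → φ-coeff (√5 ^ᵩ suc j *ᵩ y) ≡ φ-coeff (√5 ^ᵩ j *ᵩ (√5 *ᵩ y))
φ-coeff-√5^-suc j y = cong φ-coeff (shift √5 (√5 ^ᵩ j) y)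
  where
  shift : ∀ s a y → s *ᵩ a *ᵩ y ≡ a *ᵩ (s *ᵩ y)
  shift = solve-ℤφ 3 (λ s a y → s ⊗ a ⊗ y ⊜ a ⊗ (s ⊗ y)) refl

φ-coeff-√5^1+2k : ∀ k y → φ-coeff (√5 ^ᵩ suc (2 ℕ.* k) *ᵩ y) ≡ (+ 5) ^ k * φ-coeff (√5 *ᵩ y)
φ-coeff-√5^1+2k k y = trans (φ-coeff-√5^-suc (2 ℕ.* k) y) (φ-coeff-√5^2k k (√5 *ᵩ y))

φ-coeff-√5^2+2k : ∀ k y → φ-coeff (√5 ^ᵩ suc (suc (2 ℕ.* k)) *ᵩ y) ≡ (+ 5) ^ (k ℕ.+ 1) * φ-coeff y
φ-coeff-√5^2+2k k y = trans (cong (λ j → φ-coeff (√5 ^ᵩ j *ᵩ y)) (double-suc k)) (φ-coeff-√5^2k (k ℕ.+ 1) y)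
  where
  double-suc : ∀ k → 2 ℕ.+ 2 ℕ.* k ≡ 2 ℕ.* (k ℕ.+ 1)
  double-suc = ℕ-solve-∀

F-as-coeff′ : ∀ z → F z ≡ φ-coeff (1ᵩ *ᵩ φ^ z)
F-as-coeff′ z = trans (F-as-coeff z) (cong φ-coeff (sym (*ᵩ-identityˡ (φ^ z))))

L-as-coeff′ : ∀ z → L z ≡ φ-coeff (√5 *ᵩ (1ᵩ *ᵩ φ^ z))
L-as-coeff′ z = trans (L-as-coeff z) (cong (λ u → φ-coeff (√5 *ᵩ u)) (sym (*ᵩ-identityˡ (φ^ z))))

sum1-cong : ∀ n {f g : ℕ → ℤ} → (∀ j → f j ≡ g j) → sum1 n f ≡ sum1 n g
sum1-cong zero    f≡g = refl
sum1-cong (suc n) f≡g = cong₂ _+_ (sum1-cong n f≡g) (f≡g (suc n))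

*-distribˡ-sum1 : ∀ n c f → c * sum1 n f ≡ sum1 n (λ j → c * f j)
*-distribˡ-sum1 zero    c f = ℤ.*-zeroʳ c
*-distribˡ-sum1 (suc n) c f =
  trans (ℤ.*-distribˡ-+ c (sum1 n f) (f (suc n))) (cong (_+ c * f (suc n)) (*-distribˡ-sum1 n c f))

S-cong : ∀ {G H : ℤ → ℤ} → (∀ z → G z ≡ H z) → ∀ p m n → S G p m n ≡ S H p m n
S-cong G≡H p m n = sum1-cong n (λ j → cong (+ (n C j) * + (j / 2) *_) (G≡H (+ 2 * p * + j + m)))

φ-coeff-∑≤ : ∀ n f → φ-coeff (∑≤ n f) ≡ φ-coeff (f 0) + sum1 n (φ-coeff ∘ f)
φ-coeff-∑≤ zero    f = sym (ℤ.+-identityʳ (φ-coeff (f 0)))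
φ-coeff-∑≤ (suc n) f = trans (cong (_+ φ-coeff (f (suc n))) (φ-coeff-∑≤ n f)) (ℤ.+-assoc (φ-coeff (f 0)) _ _)

4S-as-coeff : ∀ g p m n →
  + 4 * S (λ z → φ-coeff (g *ᵩ φ^ z)) p m n
    ≡ φ-coeff (g *ᵩ φ^ m *ᵩ binomialSum n (λ j → (4 ℕ.* (j / 2)) ×ᵩ φ^ (+ 2 * p) ^ᵩ j))
4S-as-coeff g p m n = begin
  + 4 * sum1 n (λ j → + (n C j) * + (j / 2) * G j)     ≡⟨ *-distribˡ-sum1 n (+ 4) _ ⟩
  sum1 n (λ j → + 4 * (+ (n C j) * + (j / 2) * G j))   ≡⟨ sum1-cong n term ⟩
  sum1 n (φ-coeff ∘ t)                                  ≡⟨ trans (cong (_+ sum1 n (φ-coeff ∘ t)) t₀) (ℤ.+-identityˡ _) ⟨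
  φ-coeff (t 0) + sum1 n (φ-coeff ∘ t)                  ≡⟨ φ-coeff-∑≤ n t ⟨
  φ-coeff (binomialSum n (λ j → y *ᵩ w j))              ≡⟨ cong φ-coeff (*-distribˡ-binomialSum n y w) ⟨
  φ-coeff (y *ᵩ binomialSum n w)                        ∎
  where
  open ≡-Reasoning
  x y : ℤφ
  x = φ^ (+ 2 * p)
  y = g *ᵩ φ^ m
  G : ℕ → ℤ
  G j = φ-coeff (g *ᵩ φ^ (+ 2 * p * + j + m))
  w t : ℕ → ℤφ
  w j = (4 ℕ.* (j / 2)) ×ᵩ x ^ᵩ j
  t j = (n C j) ×ᵩ (y *ᵩ w j)
  swap : ∀ a b c → a *ᵩ (b *ᵩ c) ≡ a *ᵩ c *ᵩ b
  swap = solve-ℤφ 3 (λ a b c → a ⊗ (b ⊗ c) ⊜ a ⊗ c ⊗ b) refl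
  G-as-power : ∀ j → G j ≡ φ-coeff (y *ᵩ x ^ᵩ j)
  G-as-power j = cong φ-coeff (trans (cong (g *ᵩ_) (φ^-affine (+ 2 * p) j m)) (swap g (x ^ᵩ j) (φ^ m)))
  reorder : ∀ c q d → + 4 * (c * q * d) ≡ c * (+ 4 * q * d)
  reorder = solve-∀
  term : ∀ j → + 4 * (+ (n C j) * + (j / 2) * G j) ≡ φ-coeff (t j)
  term j = begin
    + 4 * (+ (n C j) * + (j / 2) * G j)                    ≡⟨ reorder (+ (n C j)) (+ (j / 2)) (G j) ⟩
    + (n C j) * (+ 4 * + (j / 2) * G j)                    ≡⟨ cong₂ (λ a b → + (n C j) * (a * b)) (ℤ.pos-* 4 (j / 2)) (sym (G-as-power j)) ⟨
    + (n C j) * (+ (4 ℕ.* (j / 2)) * φ-coeff (y *ᵩ x ^ᵩ j)) ≡⟨ cong (+ (n C j) *_) (φ-coeff-×ᵩ (4 ℕ.* (j / 2)) (y *ᵩ x ^ᵩ j)) ⟨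
    + (n C j) * φ-coeff ((4 ℕ.* (j / 2)) ×ᵩ (y *ᵩ x ^ᵩ j))  ≡⟨ cong (λ u → + (n C j) * φ-coeff u) (×ᵩ-comm-*ᵩ (4 ℕ.* (j / 2)) y (x ^ᵩ j)) ⟨
    + (n C j) * φ-coeff (y *ᵩ w j)                         ≡⟨ φ-coeff-×ᵩ (n C j) (y *ᵩ w j) ⟨
    φ-coeff (t j)                                          ∎
  t₀ : φ-coeff (t 0) ≡ + 0
  t₀ = trans (sym (term 0)) (vanishes (+ (n C 0)) (G 0))
    where
    vanishes : ∀ c d → + 4 * (c * + 0 * d) ≡ + 0
    vanishes = solve-∀

module _ (p : ℤ) (norm-φ^p : norm (φ^ p) ≡ - + 1) where

  private
    P x : ℤφ
    P = φ^ p
    x = φ^ (+ 2 * p)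

    x≡P*P : x ≡ P *ᵩ P
    x≡P*P = trans (cong φ^_ (double p)) (φ^-+ p p)
      where
      double : ∀ p → + 2 * p ≡ p + p
      double = solve-∀

    1+x : 1ᵩ +ᵩ x ≡ √5 *ᵩ ι (F p) *ᵩ P
    1+x = trans (cong (1ᵩ +ᵩ_) x≡P*P)
                (trans (1+square P norm-φ^p) (cong (λ c → √5 *ᵩ ι c *ᵩ P) (sym (F-as-coeff p))))

    1-x : 1ᵩ +ᵩ -ᵩ x ≡ ι (- L p) *ᵩ P
    1-x = trans (cong (λ u → 1ᵩ +ᵩ -ᵩ u) x≡P*P)
                (trans (1-square P norm-φ^p) (cong (λ c → ι (- c) *ᵩ P) (sym (L-as-coeff p))))

    [1+x]^ : ∀ n → (1ᵩ +ᵩ x) ^ᵩ n ≡ √5 ^ᵩ n *ᵩ ι (F p ^ n) *ᵩ P ^ᵩ n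
    [1+x]^ n = begin
      (1ᵩ +ᵩ x) ^ᵩ n                      ≡⟨ cong (_^ᵩ n) 1+x ⟩
      (√5 *ᵩ ι (F p) *ᵩ P) ^ᵩ n           ≡⟨ ^ᵩ-distrib-*ᵩ (√5 *ᵩ ι (F p)) P n ⟩
      (√5 *ᵩ ι (F p)) ^ᵩ n *ᵩ P ^ᵩ n      ≡⟨ cong (_*ᵩ P ^ᵩ n) (^ᵩ-distrib-*ᵩ √5 (ι (F p)) n) ⟩
      √5 ^ᵩ n *ᵩ ι (F p) ^ᵩ n *ᵩ P ^ᵩ n   ≡⟨ cong (λ u → √5 ^ᵩ n *ᵩ u *ᵩ P ^ᵩ n) (ι-^ᵩ (F p) n) ⟩
      √5 ^ᵩ n *ᵩ ι (F p ^ n) *ᵩ P ^ᵩ n    ∎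
      where open ≡-Reasoning

    [1-x]^ : ∀ n → (1ᵩ +ᵩ -ᵩ x) ^ᵩ n ≡ ι ((- L p) ^ n) *ᵩ P ^ᵩ n
    [1-x]^ n = trans (cong (_^ᵩ n) 1-x) (trans (^ᵩ-distrib-*ᵩ (ι (- L p)) P n) (cong (_*ᵩ P ^ᵩ n) (ι-^ᵩ (- L p) n)))

    x[1+x]^ : ∀ n → x *ᵩ (1ᵩ +ᵩ x) ^ᵩ n ≡ √5 ^ᵩ n *ᵩ ι (F p ^ n) *ᵩ P ^ᵩ (suc n ℕ.+ 1)
    x[1+x]^ n = begin
      x *ᵩ (1ᵩ +ᵩ x) ^ᵩ n                           ≡⟨ cong₂ _*ᵩ_ x≡P*P ([1+x]^ n) ⟩
      P *ᵩ P *ᵩ (√5 ^ᵩ n *ᵩ ι (F p ^ n) *ᵩ P ^ᵩ n)  ≡⟨ regroup P (√5 ^ᵩ n) (ι (F p ^ n)) (P ^ᵩ n) ⟩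
      √5 ^ᵩ n *ᵩ ι (F p ^ n) *ᵩ P ^ᵩ suc (suc n)    ≡⟨ cong (λ k → √5 ^ᵩ n *ᵩ ι (F p ^ n) *ᵩ P ^ᵩ k) (ℕ.+-comm 1 (suc n)) ⟩
      √5 ^ᵩ n *ᵩ ι (F p ^ n) *ᵩ P ^ᵩ (suc n ℕ.+ 1)  ∎
      where
      open ≡-Reasoning
      regroup : ∀ P s c Q → P *ᵩ P *ᵩ (s *ᵩ c *ᵩ Q) ≡ s *ᵩ c *ᵩ (P *ᵩ (P *ᵩ Q))
      regroup = solve-ℤφ 4 (λ P s c Q → P ⊗ P ⊗ (s ⊗ c ⊗ Q) ⊜ s ⊗ c ⊗ (P ⊗ (P ⊗ Q))) refl

    coeff-monomial : ∀ g m s c k →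
      φ-coeff (g *ᵩ φ^ m *ᵩ (s *ᵩ ι c *ᵩ P ^ᵩ k)) ≡ c * φ-coeff (s *ᵩ (g *ᵩ φ^ (p * + k + m)))
    coeff-monomial g m s c k = begin
      φ-coeff (g *ᵩ φ^ m *ᵩ (s *ᵩ ι c *ᵩ P ^ᵩ k))      ≡⟨ cong φ-coeff (regroup g (φ^ m) s (ι c) (P ^ᵩ k)) ⟩
      φ-coeff (ι c *ᵩ (s *ᵩ (g *ᵩ (P ^ᵩ k *ᵩ φ^ m))))  ≡⟨ φ-coeff-ι*ᵩ c (s *ᵩ (g *ᵩ (P ^ᵩ k *ᵩ φ^ m))) ⟩
      c * φ-coeff (s *ᵩ (g *ᵩ (P ^ᵩ k *ᵩ φ^ m)))        ≡⟨ cong (λ u → c * φ-coeff (s *ᵩ (g *ᵩ u))) (φ^-affine p k m) ⟨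
      c * φ-coeff (s *ᵩ (g *ᵩ φ^ (p * + k + m)))        ∎
      where
      open ≡-Reasoning
      regroup : ∀ g M s c Q → g *ᵩ M *ᵩ (s *ᵩ c *ᵩ Q) ≡ c *ᵩ (s *ᵩ (g *ᵩ (Q *ᵩ M)))
      regroup = solve-ℤφ 5 (λ g M s c Q → g ⊗ M ⊗ (s ⊗ c ⊗ Q) ⊜ c ⊗ (s ⊗ (g ⊗ (Q ⊗ M)))) refl

  -- g = 1 gives the Fibonacci sum and g = √5 the Lucas sum.
  4S-closed-form : ∀ g m n →
    + 4 * S (λ z → φ-coeff (g *ᵩ φ^ z)) p m (suc n)
      ≡ + 2 * + suc n * F p ^ n * φ-coeff (√5 ^ᵩ n *ᵩ (g *ᵩ φ^ (p * + (suc n ℕ.+ 1) + m)))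
        - F p ^ suc n * φ-coeff (√5 ^ᵩ suc n *ᵩ (g *ᵩ φ^ (p * + suc n + m)))
        + (- L p) ^ suc n * φ-coeff (g *ᵩ φ^ (p * + suc n + m))
  4S-closed-form g m n = begin
    + 4 * S (λ z → φ-coeff (g *ᵩ φ^ z)) p m N
      ≡⟨ 4S-as-coeff g p m N ⟩
    φ-coeff (y *ᵩ binomialSum N (λ j → (4 ℕ.* (j / 2)) ×ᵩ x ^ᵩ j))
      ≡⟨ cong (λ u → φ-coeff (y *ᵩ u)) (binomialSum-4⌊/2⌋ x n) ⟩
    φ-coeff (y *ᵩ (U +ᵩ U +ᵩ (1ᵩ +ᵩ -ᵩ x) ^ᵩ N +ᵩ -ᵩ (1ᵩ +ᵩ x) ^ᵩ N))
      ≡⟨ cong φ-coeff (distribute y U ((1ᵩ +ᵩ -ᵩ x) ^ᵩ N) ((1ᵩ +ᵩ x) ^ᵩ N)) ⟩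
    φ-coeff (y *ᵩ U) + φ-coeff (y *ᵩ U) + φ-coeff (y *ᵩ (1ᵩ +ᵩ -ᵩ x) ^ᵩ N) - φ-coeff (y *ᵩ (1ᵩ +ᵩ x) ^ᵩ N)
      ≡⟨ cong₂ (λ a b → a + a + b - φ-coeff (y *ᵩ (1ᵩ +ᵩ x) ^ᵩ N)) yU yB ⟩
    + N * (F p ^ n * c₁) + + N * (F p ^ n * c₁) + (- L p) ^ N * c₃ - φ-coeff (y *ᵩ (1ᵩ +ᵩ x) ^ᵩ N)
      ≡⟨ cong (λ a → + N * (F p ^ n * c₁) + + N * (F p ^ n * c₁) + (- L p) ^ N * c₃ - a) yA ⟩
    + N * (F p ^ n * c₁) + + N * (F p ^ n * c₁) + (- L p) ^ N * c₃ - F p ^ N * c₂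
      ≡⟨ rearrange (+ N) (F p ^ n) (F p ^ N) ((- L p) ^ N) c₁ c₂ c₃ ⟩
    + 2 * + N * F p ^ n * c₁ - F p ^ N * c₂ + (- L p) ^ N * c₃
      ∎
    where
    open ≡-Reasoning
    N : ℕ
    N = suc n
    y U : ℤφ
    y = g *ᵩ φ^ m
    U = N ×ᵩ (x *ᵩ (1ᵩ +ᵩ x) ^ᵩ n)
    c₁ c₂ c₃ : ℤ
    c₁ = φ-coeff (√5 ^ᵩ n *ᵩ (g *ᵩ φ^ (p * + (N ℕ.+ 1) + m)))
    c₂ = φ-coeff (√5 ^ᵩ N *ᵩ (g *ᵩ φ^ (p * + N + m)))
    c₃ = φ-coeff (g *ᵩ φ^ (p * + N + m))
    distribute : ∀ y u b a → y *ᵩ (u +ᵩ u +ᵩ b +ᵩ -ᵩ a) ≡ y *ᵩ u +ᵩ y *ᵩ u +ᵩ y *ᵩ b +ᵩ -ᵩ (y *ᵩ a)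
    distribute = solve-ℤφ 4 (λ y u b a → y ⊗ (u ⊕ u ⊕ b ⊕ ⊝ a) ⊜ (y ⊗ u ⊕ y ⊗ u ⊕ y ⊗ b ⊕ ⊝ (y ⊗ a))) refl
    rearrange : ∀ N f f′ l c₁ c₂ c₃ →
      N * (f * c₁) + N * (f * c₁) + l * c₃ - f′ * c₂ ≡ + 2 * N * f * c₁ - f′ * c₂ + l * c₃
    rearrange = solve-∀
    yU : φ-coeff (y *ᵩ U) ≡ + N * (F p ^ n * c₁)
    yU = begin
      φ-coeff (y *ᵩ U)                                                 ≡⟨ cong φ-coeff (×ᵩ-comm-*ᵩ N y _) ⟩
      φ-coeff (N ×ᵩ (y *ᵩ (x *ᵩ (1ᵩ +ᵩ x) ^ᵩ n)))                       ≡⟨ φ-coeff-×ᵩ N _ ⟩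
      + N * φ-coeff (y *ᵩ (x *ᵩ (1ᵩ +ᵩ x) ^ᵩ n))                        ≡⟨ cong (λ u → + N * φ-coeff (y *ᵩ u)) (x[1+x]^ n) ⟩
      + N * φ-coeff (y *ᵩ (√5 ^ᵩ n *ᵩ ι (F p ^ n) *ᵩ P ^ᵩ (N ℕ.+ 1)))  ≡⟨ cong (+ N *_) (coeff-monomial g m (√5 ^ᵩ n) (F p ^ n) (N ℕ.+ 1)) ⟩
      + N * (F p ^ n * c₁)                                              ∎
    yA : φ-coeff (y *ᵩ (1ᵩ +ᵩ x) ^ᵩ N) ≡ F p ^ N * c₂
    yA = trans (cong (λ u → φ-coeff (y *ᵩ u)) ([1+x]^ N)) (coeff-monomial g m (√5 ^ᵩ N) (F p ^ N) N)
    yB : φ-coeff (y *ᵩ (1ᵩ +ᵩ -ᵩ x) ^ᵩ N) ≡ (- L p) ^ N * c₃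
    yB = begin
      φ-coeff (y *ᵩ (1ᵩ +ᵩ -ᵩ x) ^ᵩ N)                       ≡⟨ cong (λ u → φ-coeff (y *ᵩ u)) ([1-x]^ N) ⟩
      φ-coeff (y *ᵩ (ι ((- L p) ^ N) *ᵩ P ^ᵩ N))             ≡⟨ cong (λ u → φ-coeff (y *ᵩ (u *ᵩ P ^ᵩ N))) (*ᵩ-identityˡ (ι ((- L p) ^ N))) ⟨
      φ-coeff (y *ᵩ (1ᵩ *ᵩ ι ((- L p) ^ N) *ᵩ P ^ᵩ N))       ≡⟨ coeff-monomial g m 1ᵩ ((- L p) ^ N) N ⟩
      (- L p) ^ N * φ-coeff (1ᵩ *ᵩ (g *ᵩ φ^ (p * + N + m)))  ≡⟨ cong (λ u → (- L p) ^ N * φ-coeff u) (*ᵩ-identityˡ (g *ᵩ φ^ (p * + N + m))) ⟩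
      (- L p) ^ N * c₃                                       ∎

-a^2k : ∀ a k → (- a) ^ (2 ℕ.* k) ≡ a ^ (2 ℕ.* k)
-a^2k a k = begin
  (- a) ^ (2 ℕ.* k)  ≡⟨ ℤ.^-*-assoc (- a) 2 k ⟨
  ((- a) ^ 2) ^ k    ≡⟨ cong (_^ k) (square a) ⟩
  (a ^ 2) ^ k        ≡⟨ ℤ.^-*-assoc a 2 k ⟩
  a ^ (2 ℕ.* k)      ∎
  where
  open ≡-Reasoning
  square : ∀ a → - a * (- a * + 1) ≡ a * (a * + 1)
  square = solve-∀

-a^1+2k : ∀ a k → (- a) ^ suc (2 ℕ.* k) ≡ - a ^ suc (2 ℕ.* k)
-a^1+2k a k = trans (cong (- a *_) (-a^2k a k)) (sym (ℤ.neg-distribˡ-* a (a ^ (2 ℕ.* k))))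

-a^2+2k : ∀ a k → (- a) ^ suc (suc (2 ℕ.* k)) ≡ a ^ suc (suc (2 ℕ.* k))
-a^2+2k a k = trans (cong (- a *_) (-a^1+2k a k)) (neg*neg a (a ^ suc (2 ℕ.* k)))
  where
  neg*neg : ∀ a b → - a * - b ≡ a * b
  neg*neg = solve-∀

4S-odd-length : ∀ m p → norm (φ^ p) ≡ - + 1 → ∀ n k → n ≡ 1 ℕ.+ 2 ℕ.* k →
      (+ 4 * S F p m n ≡ + 2 * + n * (+ 5) ^ k * F p ^ (n ℕ.∸ 1) * F (p * + (n ℕ.+ 1) + m)
                       - (+ 5) ^ k * F p ^ n * L (p * + n + m)
                       - L p ^ n * F (p * + n + m))
      × (+ 4 * S L p m n ≡ + 2 * + n * (+ 5) ^ k * F p ^ (n ℕ.∸ 1) * L (p * + (n ℕ.+ 1) + m)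
                       - (+ 5) ^ (k ℕ.+ 1) * F p ^ n * F (p * + n + m)
                       - L p ^ n * L (p * + n + m))
4S-odd-length m p norm-φ^p n k refl =
    trans (cong (+ 4 *_) (S-cong F-as-coeff′ p m n)) (trans (4S-closed-form p norm-φ^p 1ᵩ m (2 ℕ.* k))
      (collect ((+ 5) ^ k) ((+ 5) ^ k) (F z₁) (L z₂) (F z₂)
        (trans (φ-coeff-√5^2k k (1ᵩ *ᵩ φ^ z₁)) (cong ((+ 5) ^ k *_) (sym (F-as-coeff′ z₁))))
        (trans (φ-coeff-√5^1+2k k (1ᵩ *ᵩ φ^ z₂)) (cong ((+ 5) ^ k *_) (sym (L-as-coeff′ z₂))))
        (sym (F-as-coeff′ z₂))))
  , trans (cong (+ 4 *_) (S-cong L-as-coeff p m n)) (trans (4S-closed-form p norm-φ^p √5 m (2 ℕ.* k))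
      (collect ((+ 5) ^ k) ((+ 5) ^ (k ℕ.+ 1)) (L z₁) (F z₂) (L z₂)
        (trans (φ-coeff-√5^2k k (√5 *ᵩ φ^ z₁)) (cong ((+ 5) ^ k *_) (sym (L-as-coeff z₁))))
        (trans (sym (φ-coeff-√5^-suc (suc (2 ℕ.* k)) (φ^ z₂)))
               (trans (φ-coeff-√5^2+2k k (φ^ z₂)) (cong ((+ 5) ^ (k ℕ.+ 1) *_) (sym (F-as-coeff z₂)))))
        (sym (L-as-coeff z₂))))
  where
  z₁ z₂ : ℤ
  z₁ = p * + (n ℕ.+ 1) + m
  z₂ = p * + n + m
  collect : ∀ e₁ e₂ X Y Z {c₁ c₂ c₃} → c₁ ≡ e₁ * X → c₂ ≡ e₂ * Y → c₃ ≡ Z →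
    + 2 * + n * F p ^ (2 ℕ.* k) * c₁ - F p ^ n * c₂ + (- L p) ^ n * c₃
      ≡ + 2 * + n * e₁ * F p ^ (2 ℕ.* k) * X - e₂ * F p ^ n * Y - L p ^ n * Z
  collect e₁ e₂ X Y Z refl refl refl =
    trans (cong (λ l → + 2 * + n * F p ^ (2 ℕ.* k) * (e₁ * X) - F p ^ n * (e₂ * Y) + l * Z) (-a^1+2k (L p) k))
          (identity (+ n) (F p ^ (2 ℕ.* k)) (F p ^ n) (L p ^ n) e₁ e₂ X Y Z)
    where
    identity : ∀ n f f′ l e₁ e₂ X Y Z →
      + 2 * n * f * (e₁ * X) - f′ * (e₂ * Y) + - l * Z ≡ + 2 * n * e₁ * f * X - e₂ * f′ * Y - l * Z
    identity = solve-∀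

4S-even-length : ∀ m p → norm (φ^ p) ≡ - + 1 → ∀ n k → n ≡ 2 ℕ.+ 2 ℕ.* k →
      (+ 4 * S F p m n ≡ + 2 * + n * (+ 5) ^ k * F p ^ (n ℕ.∸ 1) * L (p * + (n ℕ.+ 1) + m)
                       - (+ 5) ^ (k ℕ.+ 1) * F p ^ n * F (p * + n + m)
                       + L p ^ n * F (p * + n + m))
      × (+ 4 * S L p m n ≡ + 2 * + n * (+ 5) ^ (k ℕ.+ 1) * F p ^ (n ℕ.∸ 1) * F (p * + (n ℕ.+ 1) + m)
                       - (+ 5) ^ (k ℕ.+ 1) * F p ^ n * L (p * + n + m)
                       + L p ^ n * L (p * + n + m))
4S-even-length m p norm-φ^p n k refl =
    trans (cong (+ 4 *_) (S-cong F-as-coeff′ p m n)) (trans (4S-closed-form p norm-φ^p 1ᵩ m (suc (2 ℕ.* k)))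
      (collect ((+ 5) ^ k) ((+ 5) ^ (k ℕ.+ 1)) (L z₁) (F z₂) (F z₂)
        (trans (φ-coeff-√5^1+2k k (1ᵩ *ᵩ φ^ z₁)) (cong ((+ 5) ^ k *_) (sym (L-as-coeff′ z₁))))
        (trans (φ-coeff-√5^2+2k k (1ᵩ *ᵩ φ^ z₂)) (cong ((+ 5) ^ (k ℕ.+ 1) *_) (sym (F-as-coeff′ z₂))))
        (sym (F-as-coeff′ z₂))))
  , trans (cong (+ 4 *_) (S-cong L-as-coeff p m n)) (trans (4S-closed-form p norm-φ^p √5 m (suc (2 ℕ.* k)))
      (collect ((+ 5) ^ (k ℕ.+ 1)) ((+ 5) ^ (k ℕ.+ 1)) (F z₁) (L z₂) (L z₂)
        (trans (sym (φ-coeff-√5^-suc (suc (2 ℕ.* k)) (φ^ z₁)))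
               (trans (φ-coeff-√5^2+2k k (φ^ z₁)) (cong ((+ 5) ^ (k ℕ.+ 1) *_) (sym (F-as-coeff z₁)))))
        (trans (φ-coeff-√5^2+2k k (√5 *ᵩ φ^ z₂)) (cong ((+ 5) ^ (k ℕ.+ 1) *_) (sym (L-as-coeff z₂))))
        (sym (L-as-coeff z₂))))
  where
  z₁ z₂ : ℤ
  z₁ = p * + (n ℕ.+ 1) + m
  z₂ = p * + n + m
  collect : ∀ e₁ e₂ X Y Z {c₁ c₂ c₃} → c₁ ≡ e₁ * X → c₂ ≡ e₂ * Y → c₃ ≡ Z →
    + 2 * + n * F p ^ suc (2 ℕ.* k) * c₁ - F p ^ n * c₂ + (- L p) ^ n * c₃
      ≡ + 2 * + n * e₁ * F p ^ suc (2 ℕ.* k) * X - e₂ * F p ^ n * Y + L p ^ n * Z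
  collect e₁ e₂ X Y Z refl refl refl =
    trans (cong (λ l → + 2 * + n * F p ^ suc (2 ℕ.* k) * (e₁ * X) - F p ^ n * (e₂ * Y) + l * Z) (-a^2+2k (L p) k))
          (identity (+ n) (F p ^ suc (2 ℕ.* k)) (F p ^ n) (L p ^ n) e₁ e₂ X Y Z)
    where
    identity : ∀ n f f′ l e₁ e₂ X Y Z →
      + 2 * n * f * (e₁ * X) - f′ * (e₂ * Y) + l * Z ≡ + 2 * n * e₁ * f * X - e₂ * f′ * Y + l * Z
    identity = solve-∀

-- The hypothesis 1 ≤ n is implied by either parity assumption.
theorem16 : (m p : ℤ) → (∃[ t ] p ≡ + 2 * t + + 1) → (n : ℕ) → 1 ℕ.≤ n →
    ((k : ℕ) → n ≡ 1 ℕ.+ 2 ℕ.* k →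
      (+ 4 * S F p m n ≡ + 2 * + n * (+ 5) ^ k * F p ^ (n ℕ.∸ 1) * F (p * + (n ℕ.+ 1) + m)
                       - (+ 5) ^ k * F p ^ n * L (p * + n + m)
                       - L p ^ n * F (p * + n + m))
      × (+ 4 * S L p m n ≡ + 2 * + n * (+ 5) ^ k * F p ^ (n ℕ.∸ 1) * L (p * + (n ℕ.+ 1) + m)
                       - (+ 5) ^ (k ℕ.+ 1) * F p ^ n * F (p * + n + m)
                       - L p ^ n * L (p * + n + m)))
    × ((k : ℕ) → n ≡ 2 ℕ.+ 2 ℕ.* k →
      (+ 4 * S F p m n ≡ + 2 * + n * (+ 5) ^ k * F p ^ (n ℕ.∸ 1) * L (p * + (n ℕ.+ 1) + m)
                       - (+ 5) ^ (k ℕ.+ 1) * F p ^ n * F (p * + n + m)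
                       + L p ^ n * F (p * + n + m))
      × (+ 4 * S L p m n ≡ + 2 * + n * (+ 5) ^ (k ℕ.+ 1) * F p ^ (n ℕ.∸ 1) * F (p * + (n ℕ.+ 1) + m)
                       - (+ 5) ^ (k ℕ.+ 1) * F p ^ n * L (p * + n + m)
                       + L p ^ n * L (p * + n + m)))
theorem16 m p (t , refl) n _ = 4S-odd-length m p (norm-φ^-odd t) n , 4S-even-length m p (norm-φ^-odd t) n
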